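{- Let $t_n=(-1)^{s_2(n)}$ for $n\in\mathbb{N}$, where $s_2(n)$ is the number of 1's in the binary expansion of $n$. Let $h_0=0$, $h_1=1$ and $h_n=t_nh_{n-1}+h_{n-2}$ for $n\ge 2$. Then: (1) For each $n\in\mathbb{N}_{+}$ we have $h_{2n+1}=t_{2n+1}h_{2n-2}$. (2) For each $n\in\mathbb{N}_{+}$ such that $t_n\neq t_{n-1}$ we have $h_{4n}=t_nh_{4n-3}$. (3) The sequence $(u_n)_{n\in\mathbb{N}}$ defined by $u_n=\operatorname{sign}(h_n)$ is $2$-automatic; more precisely, $u_0=u_3=0$, $u_{2n}=-1$ for all $n\neq 0$, and $u_{2n+1}=t_n$ for all $n\neq 1$.
   Context: $\mathbb{N}$ denotes the non-negative integers and $\mathbb{N}_{+}$ the positive integers. $(t_n)$ is the Prouhet–Thue–Morse sequence (it satisfies $t_0=1$, $t_{2n}=t_n$, $t_{2n+1}=-t_n$). A sequence $(a_n)_{n\in\mathbb{N}}$ is $k$-automatic if its $k$-kernel $\{(a_{k^in+j})_{n\in\mathbb{N}}: i\in\mathbb{N},\ 0\le j<k^i\}$ is finite (equivalently, $a_n$ is a finite-state function of the base-$k$ digits of $n$). -}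

module Defs where

open import Data.Nat as ℕ using (ℕ; zero; suc; _<_; _/_; _%_; _^_)
open import Data.Integer as ℤ using (ℤ; +_; -[1+_]; -_)
open import Data.List using (List)
open import Data.List.Relation.Unary.Any using (Any)
open import Data.Product using (∃; _×_)
open import Relation.Binary.PropositionalEquality using (_≡_)

s₂-fuel : ℕ → ℕ → ℕ
s₂-fuel zero    n = 0
s₂-fuel (suc k) n = n % 2 ℕ.+ s₂-fuel k (n / 2)

-- s₂ n = number of 1's in the binary expansion of n (n ≥ number of binary digits of n)
s₂ : ℕ → ℕ
s₂ n = s₂-fuel n n

neg1^ : ℕ → ℤ
neg1^ zero    = + 1
neg1^ (suc k) = - neg1^ k

t : ℕ → ℤ
t n = neg1^ (s₂ n)

h : ℕ → ℤ
h zero = + 0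
h (suc zero) = + 1
h (suc (suc n)) = t (suc (suc n)) ℤ.* h (suc n) ℤ.+ h n

sgn : ℤ → ℤ
sgn (+ zero)  = + 0
sgn (+ suc _) = + 1
sgn -[1+ _ ]  = -[1+ 0 ]

u : ℕ → ℤ
u n = sgn (h n)

-- k-automatic: the k-kernel {(a (k^i n + j))_n : i ∈ ℕ, 0 ≤ j < k^i} is finite,
-- i.e. there is a finite list of sequences such that every kernel element
-- equals (pointwise) one of them.
Automatic : ℕ → (ℕ → ℤ) → Set
Automatic k a =
  ∃ λ (L : List (ℕ → ℤ)) →
    ∀ (i j : ℕ) → j < k ^ i →
      Any (λ f → ∀ n → a (k ^ i ℕ.* n ℕ.+ j) ≡ f n) L

-- Since t(2n+1) = -t(2n) and t(n)² = 1, two steps of the recurrence collapse to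
-- h(2m+3) = t(2m+3) h(2m), which is (1); one more step gives (2).  Substituting (1) into
-- the even step gives h(2m+4) = ε h(2m) + h(2m+2) with ε = ±1, and ε = 1 for odd m, so
-- the pairs (h(4k+2), h(4k+4)) stay negative: u(2n) = -1, and then (1) gives u(2n+1) = t(n).
-- As t(2ⁱn + q) = t(n) t(q) for q < 2ⁱ, each kernel sequence n ↦ u(2ⁱn + j) is one of
-- seven explicit sequences.

module Submission where

open import Data.Empty using (⊥-elim)
open import Data.Integer as ℤ using (ℤ; +_; -[1+_]; 0ℤ; 1ℤ; -1ℤ; -_; +<+; -<+)
import Data.Integer.Properties as ℤₚ
open import Data.Integer.Tactic.RingSolver using (solve-∀)
open import Data.List using (List; _∷_; [])
open import Data.List.Membership.Propositional using (lose)
open import Data.List.Relation.Unary.Any as Any using (Any; here; there)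
open import Data.Nat using (ℕ; zero; suc; _+_; _*_; _∸_; _^_; _≤_; _<_; z≤n; s≤s; _/_; _%_; _≟_)
import Data.Nat.Properties as ℕₚ
open import Data.Nat.DivMod using ([m+kn]%n≡m%n; m<n⇒m%n≡m; +-distrib-/-∣ʳ; m<n⇒m/n≡0; m*n/n≡m; m/n<m)
open import Data.Nat.Divisibility using (n∣m*n)
import Data.Nat.Tactic.RingSolver as ℕ-Ring
open import Data.Product using (_×_; _,_; proj₁; proj₂)
open import Data.Sum using (_⊎_; inj₁; inj₂)
open import Function using (_∘_; const)
open import Relation.Binary.PropositionalEquality
open import Relation.Nullary using (yes; no)

open import Defs

data ParityView : ℕ → Set where
  even : ∀ k → ParityView (2 * k)
  odd  : ∀ k → ParityView (1 + 2 * k)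

parityView : ∀ n → ParityView n
parityView zero = even 0
parityView (suc n) with parityView n
... | even k = odd k
... | odd k  = subst ParityView (ℕₚ.*-suc 2 k) (even (suc k))

s₂-fuel-zero : ∀ k → s₂-fuel k 0 ≡ 0
s₂-fuel-zero zero    = refl
s₂-fuel-zero (suc k) = s₂-fuel-zero k

/2-≤ : ∀ {n k} → n ≤ suc k → n / 2 ≤ k
/2-≤ {zero}  _     = z≤n
/2-≤ {suc n} n≤1+k = ℕₚ.≤-pred (ℕₚ.≤-trans (m/n<m (suc n) 2 (s≤s (s≤s z≤n))) n≤1+k)

s₂-fuel-stable : ∀ k m n → n ≤ k → n ≤ m → s₂-fuel k n ≡ s₂-fuel m n
s₂-fuel-stable zero    m       zero _   _   = sym (s₂-fuel-zero m)
s₂-fuel-stable (suc k) zero    zero _   _   = s₂-fuel-zero (suc k)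
s₂-fuel-stable (suc k) (suc m) n    n≤k n≤m =
  cong (λ s → n % 2 + s) (s₂-fuel-stable k m (n / 2) (/2-≤ n≤k) (/2-≤ n≤m))

s₂-fuel-≥ : ∀ {k n} → n ≤ k → s₂-fuel k n ≡ s₂ n
s₂-fuel-≥ {k} {n} n≤k = s₂-fuel-stable k n n n≤k ℕₚ.≤-refl

s₂-fuel-digit : ∀ k r n → r < 2 → s₂-fuel (suc k) (r + n * 2) ≡ r + s₂-fuel k n
s₂-fuel-digit k r n r<2 = cong₂ _+_ lowest-digit (cong (s₂-fuel k) quotient)
  where
  lowest-digit : (r + n * 2) % 2 ≡ r
  lowest-digit = trans ([m+kn]%n≡m%n r n 2) (m<n⇒m%n≡m r<2)
  quotient : (r + n * 2) / 2 ≡ n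
  quotient = trans (+-distrib-/-∣ʳ r (n∣m*n n)) (cong₂ _+_ (m<n⇒m/n≡0 r<2) (m*n/n≡m n 2))

s₂-double : ∀ n → s₂ (2 * n) ≡ s₂ n
s₂-double zero      = refl
s₂-double n@(suc m) = begin
  s₂-fuel (suc k) (2 * n)     ≡⟨ cong (s₂-fuel (suc k)) (ℕₚ.*-comm 2 n) ⟩
  s₂-fuel (suc k) (0 + n * 2) ≡⟨ s₂-fuel-digit k 0 n (s≤s z≤n) ⟩
  s₂-fuel k n                 ≡⟨ s₂-fuel-≥ (ℕₚ.≤-trans (ℕₚ.m≤m+n n 0) (ℕₚ.m≤n+m (n + 0) m)) ⟩
  s₂ n                        ∎
  where
  open ≡-Reasoning
  k = m + (n + 0)

s₂-double+1 : ∀ n → s₂ (1 + 2 * n) ≡ 1 + s₂ n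
s₂-double+1 n = begin
  s₂-fuel (1 + 2 * n) (1 + 2 * n) ≡⟨ cong (s₂-fuel (1 + 2 * n) ∘ suc) (ℕₚ.*-comm 2 n) ⟩
  s₂-fuel (1 + 2 * n) (1 + n * 2) ≡⟨ s₂-fuel-digit (2 * n) 1 n (s≤s (s≤s z≤n)) ⟩
  1 + s₂-fuel (2 * n) n           ≡⟨ cong suc (s₂-fuel-≥ (ℕₚ.m≤m+n n (n + 0))) ⟩
  1 + s₂ n                        ∎
  where open ≡-Reasoning

t-double : ∀ n → t (2 * n) ≡ t n
t-double n = cong neg1^ (s₂-double n)

t-double+1 : ∀ n → t (1 + 2 * n) ≡ - t n
t-double+1 n = cong neg1^ (s₂-double+1 n)

t-double-suc : ∀ n → t (2 + 2 * n) ≡ t (1 + n)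
t-double-suc n = trans (cong t (sym (ℕₚ.*-suc 2 n))) (t-double (suc n))

t-double+1-suc : ∀ n → t (3 + 2 * n) ≡ - t (1 + n)
t-double+1-suc n = trans (cong (t ∘ suc) (sym (ℕₚ.*-suc 2 n))) (t-double+1 (suc n))

IsSign : ℤ → Set
IsSign a = a ≡ 1ℤ ⊎ a ≡ -1ℤ

neg1^-isSign : ∀ k → IsSign (neg1^ k)
neg1^-isSign zero = inj₁ refl
neg1^-isSign (suc k) with neg1^-isSign k
... | inj₁ a≡1  = inj₂ (cong -_ a≡1)
... | inj₂ a≡-1 = inj₁ (cong -_ a≡-1)

t-isSign : ∀ n → IsSign (t n)
t-isSign n = neg1^-isSign (s₂ n)

isSign-* : ∀ {a b} → IsSign a → IsSign b → IsSign (a ℤ.* b)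
isSign-* (inj₁ refl) (inj₁ refl) = inj₁ refl
isSign-* (inj₁ refl) (inj₂ refl) = inj₂ refl
isSign-* (inj₂ refl) (inj₁ refl) = inj₂ refl
isSign-* (inj₂ refl) (inj₂ refl) = inj₁ refl

isSign-≢⇒≡- : ∀ {a b} → IsSign a → IsSign b → a ≢ b → a ≡ - b
isSign-≢⇒≡- (inj₁ refl) (inj₁ refl) a≢b = ⊥-elim (a≢b refl)
isSign-≢⇒≡- (inj₁ refl) (inj₂ refl) _   = refl
isSign-≢⇒≡- (inj₂ refl) (inj₁ refl) _   = refl
isSign-≢⇒≡- (inj₂ refl) (inj₂ refl) a≢b = ⊥-elim (a≢b refl)

-a*-a≡1 : ∀ {a} → IsSign a → - a ℤ.* - a ≡ 1ℤ
-a*-a≡1 (inj₁ refl) = refl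
-a*-a≡1 (inj₂ refl) = refl

-a*[a*y+x]+y≡-a*x : ∀ {a} → IsSign a → ∀ x y → - a ℤ.* (a ℤ.* y ℤ.+ x) ℤ.+ y ≡ - a ℤ.* x
-a*[a*y+x]+y≡-a*x (inj₁ refl) = solve-∀
-a*[a*y+x]+y≡-a*x (inj₂ refl) = solve-∀

-a*[a*x]+[-a*y+x]≡-a*y : ∀ {a} → IsSign a → ∀ x y → - a ℤ.* (a ℤ.* x) ℤ.+ (- a ℤ.* y ℤ.+ x) ≡ - a ℤ.* y
-a*[a*x]+[-a*y+x]≡-a*y (inj₁ refl) = solve-∀
-a*[a*x]+[-a*y+x]≡-a*y (inj₂ refl) = solve-∀

h[3+2m]≡t[3+2m]*h[2m] : ∀ m → h (3 + 2 * m) ≡ t (3 + 2 * m) ℤ.* h (2 * m)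
h[3+2m]≡t[3+2m]*h[2m] m = begin
  t (3 + 2 * m) ℤ.* (a ℤ.* h (1 + 2 * m) ℤ.+ h (2 * m)) ℤ.+ h (1 + 2 * m)
    ≡⟨ cong (λ b → b ℤ.* h (2 + 2 * m) ℤ.+ h (1 + 2 * m)) t[3+2m]≡-a ⟩
  - a ℤ.* (a ℤ.* h (1 + 2 * m) ℤ.+ h (2 * m)) ℤ.+ h (1 + 2 * m)
    ≡⟨ -a*[a*y+x]+y≡-a*x (t-isSign (2 + 2 * m)) _ _ ⟩
  - a ℤ.* h (2 * m)
    ≡⟨ cong (ℤ._* h (2 * m)) (sym t[3+2m]≡-a) ⟩
  t (3 + 2 * m) ℤ.* h (2 * m)
    ∎
  where
  open ≡-Reasoning
  a = t (2 + 2 * m)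
  t[3+2m]≡-a : t (3 + 2 * m) ≡ - a
  t[3+2m]≡-a = trans (t-double+1-suc m) (cong -_ (sym (t-double-suc m)))

h[4+4m]≡t[1+m]*h[1+4m] : ∀ m → t (1 + m) ≢ t m →
                         h (4 + 2 * (2 * m)) ≡ t (1 + m) ℤ.* h (1 + 2 * (2 * m))
h[4+4m]≡t[1+m]*h[1+4m] m t[1+m]≢t[m] = begin
  t (4 + k) ℤ.* h (3 + k) ℤ.+ h (2 + k)
    ≡⟨ cong (λ x → t (4 + k) ℤ.* x ℤ.+ h (2 + k)) (h[3+2m]≡t[3+2m]*h[2m] (2 * m)) ⟩
  t (4 + k) ℤ.* (t (3 + k) ℤ.* h k) ℤ.+ (t (2 + k) ℤ.* h (1 + k) ℤ.+ h k)
    ≡⟨ cong₂ (λ b c → b ℤ.* (c ℤ.* h k) ℤ.+ (t (2 + k) ℤ.* h (1 + k) ℤ.+ h k)) t[4+k]≡-a t[3+k]≡a ⟩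
  - a ℤ.* (a ℤ.* h k) ℤ.+ (t (2 + k) ℤ.* h (1 + k) ℤ.+ h k)
    ≡⟨ cong (λ c → - a ℤ.* (a ℤ.* h k) ℤ.+ (c ℤ.* h (1 + k) ℤ.+ h k)) (t-double-suc (2 * m)) ⟩
  - a ℤ.* (a ℤ.* h k) ℤ.+ (t (1 + 2 * m) ℤ.* h (1 + k) ℤ.+ h k)
    ≡⟨ cong (λ c → - a ℤ.* (a ℤ.* h k) ℤ.+ (c ℤ.* h (1 + k) ℤ.+ h k)) (t-double+1 m) ⟩
  - a ℤ.* (a ℤ.* h k) ℤ.+ (- a ℤ.* h (1 + k) ℤ.+ h k)
    ≡⟨ -a*[a*x]+[-a*y+x]≡-a*y (t-isSign m) (h k) (h (1 + k)) ⟩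
  - a ℤ.* h (1 + k)
    ≡⟨ cong (ℤ._* h (1 + k)) (sym t[1+m]≡-a) ⟩
  t (1 + m) ℤ.* h (1 + k)
    ∎
  where
  open ≡-Reasoning
  k = 2 * (2 * m)
  a = t m
  t[1+m]≡-a : t (1 + m) ≡ - a
  t[1+m]≡-a = isSign-≢⇒≡- (t-isSign (1 + m)) (t-isSign m) t[1+m]≢t[m]
  t[4+k]≡-a : t (4 + k) ≡ - a
  t[4+k]≡-a = begin
    t (2 + (2 + 2 * (2 * m))) ≡⟨ cong (λ i → t (2 + i)) (sym (ℕₚ.*-suc 2 (2 * m))) ⟩
    t (2 + 2 * (1 + 2 * m))   ≡⟨ t-double-suc (1 + 2 * m) ⟩
    t (2 + 2 * m)             ≡⟨ t-double-suc m ⟩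
    t (1 + m)                 ≡⟨ t[1+m]≡-a ⟩
    - a                       ∎
  t[3+k]≡a : t (3 + k) ≡ a
  t[3+k]≡a = begin
    t (3 + 2 * (2 * m)) ≡⟨ t-double+1-suc (2 * m) ⟩
    - t (1 + 2 * m)     ≡⟨ cong -_ (t-double+1 m) ⟩
    - - a               ≡⟨ ℤₚ.neg-involutive a ⟩
    a                   ∎

h[4+2m]≡ε*h[2m]+h[2+2m] : ∀ m → h (2 * (2 + m)) ≡ (t (2 + m) ℤ.* t (3 + 2 * m)) ℤ.* h (2 * m) ℤ.+ h (2 * (1 + m))
h[4+2m]≡ε*h[2m]+h[2+2m] m = begin
  h (2 * (2 + m))
    ≡⟨ cong h (trans (ℕₚ.*-suc 2 (1 + m)) (cong (λ i → 2 + i) (ℕₚ.*-suc 2 m))) ⟩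
  t (4 + 2 * m) ℤ.* h (3 + 2 * m) ℤ.+ h (2 + 2 * m)
    ≡⟨ cong₂ (λ b x → b ℤ.* x ℤ.+ h (2 + 2 * m)) t[4+2m]≡t[2+m] (h[3+2m]≡t[3+2m]*h[2m] m) ⟩
  t (2 + m) ℤ.* (t (3 + 2 * m) ℤ.* h (2 * m)) ℤ.+ h (2 + 2 * m)
    ≡⟨ cong₂ ℤ._+_ (sym (ℤₚ.*-assoc (t (2 + m)) _ _)) (cong h (sym (ℕₚ.*-suc 2 m))) ⟩
  (t (2 + m) ℤ.* t (3 + 2 * m)) ℤ.* h (2 * m) ℤ.+ h (2 * (1 + m))
    ∎
  where
  open ≡-Reasoning
  t[4+2m]≡t[2+m] : t (4 + 2 * m) ≡ t (2 + m)
  t[4+2m]≡t[2+m] = trans (cong (λ i → t (2 + i)) (sym (ℕₚ.*-suc 2 m))) (t-double-suc (1 + m))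

sign*y+[x+y]<0 : ∀ {ε x y} → IsSign ε → x ℤ.< 0ℤ → y ℤ.< 0ℤ → ε ℤ.* y ℤ.+ (x ℤ.+ y) ℤ.< 0ℤ
sign*y+[x+y]<0 {x = x} {y} (inj₁ refl) x<0 y<0 =
  subst (ℤ._< 0ℤ) (cong (ℤ._+ (x ℤ.+ y)) (sym (ℤₚ.*-identityˡ y))) (ℤₚ.+-mono-< y<0 (ℤₚ.+-mono-< x<0 y<0))
sign*y+[x+y]<0 {x = x} {y} (inj₂ refl) x<0 _ = subst (ℤ._< 0ℤ) (sym (-y+[x+y]≡x x y)) x<0
  where
  -y+[x+y]≡x : ∀ x y → -1ℤ ℤ.* y ℤ.+ (x ℤ.+ y) ≡ x
  -y+[x+y]≡x = solve-∀

h-double-negative-pair : ∀ k → h (2 * (1 + 2 * k)) ℤ.< 0ℤ × h (2 * (2 + 2 * k)) ℤ.< 0ℤ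
h-double-negative-pair zero    = -<+ , -<+
h-double-negative-pair (suc k) with h-double-negative-pair k
... | x<0 , y<0 =
  subst (λ i → h (2 * i) ℤ.< 0ℤ) (cong suc (sym (ℕₚ.*-suc 2 k)))
        (subst (ℤ._< 0ℤ) (sym h[6+4k]≡x+y) (ℤₚ.+-mono-< x<0 y<0)) ,
  subst (λ i → h (2 * i) ℤ.< 0ℤ) (cong (λ i → 2 + i) (sym (ℕₚ.*-suc 2 k)))
        (subst (ℤ._< 0ℤ) (sym h[8+4k]≡ε*y+[x+y])
               (sign*y+[x+y]<0 (isSign-* (t-isSign (4 + 2 * k)) (t-isSign (3 + 2 * (2 + 2 * k)))) x<0 y<0))
  where
  open ≡-Reasoning
  x = h (2 * (1 + 2 * k))
  y = h (2 * (2 + 2 * k))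
  ε = t (4 + 2 * k) ℤ.* t (3 + 2 * (2 + 2 * k))
  t[3+2k]*t[5+4k]≡1 : t (3 + 2 * k) ℤ.* t (3 + 2 * (1 + 2 * k)) ≡ 1ℤ
  t[3+2k]*t[5+4k]≡1 = begin
    t (3 + 2 * k) ℤ.* t (3 + 2 * (1 + 2 * k)) ≡⟨ cong (t (3 + 2 * k) ℤ.*_) (t-double+1-suc (1 + 2 * k)) ⟩
    t (3 + 2 * k) ℤ.* - t (2 + 2 * k)         ≡⟨ cong₂ (λ b c → b ℤ.* - c) (t-double+1-suc k) (t-double-suc k) ⟩
    - t (1 + k) ℤ.* - t (1 + k)               ≡⟨ -a*-a≡1 (t-isSign (1 + k)) ⟩
    1ℤ                                        ∎
  h[6+4k]≡x+y : h (2 * (3 + 2 * k)) ≡ x ℤ.+ y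
  h[6+4k]≡x+y = begin
    h (2 * (3 + 2 * k))                                    ≡⟨ h[4+2m]≡ε*h[2m]+h[2+2m] (1 + 2 * k) ⟩
    (t (3 + 2 * k) ℤ.* t (3 + 2 * (1 + 2 * k))) ℤ.* x ℤ.+ y ≡⟨ cong (λ δ → δ ℤ.* x ℤ.+ y) t[3+2k]*t[5+4k]≡1 ⟩
    1ℤ ℤ.* x ℤ.+ y                                         ≡⟨ cong (ℤ._+ y) (ℤₚ.*-identityˡ x) ⟩
    x ℤ.+ y                                                ∎
  h[8+4k]≡ε*y+[x+y] : h (2 * (4 + 2 * k)) ≡ ε ℤ.* y ℤ.+ (x ℤ.+ y)
  h[8+4k]≡ε*y+[x+y] = trans (h[4+2m]≡ε*h[2m]+h[2+2m] (2 + 2 * k)) (cong (λ z → ε ℤ.* y ℤ.+ z) h[6+4k]≡x+y)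

h-double-negative : ∀ n → h (2 * suc n) ℤ.< 0ℤ
h-double-negative n with parityView n
... | even k = proj₁ (h-double-negative-pair k)
... | odd k  = proj₂ (h-double-negative-pair k)

sgn-negative : ∀ {x} → x ℤ.< 0ℤ → sgn x ≡ -1ℤ
sgn-negative { -[1+ _ ]} _ = refl
sgn-negative {+ _} (+<+ ())

sgn-sign*negative : ∀ {a x} → IsSign a → x ℤ.< 0ℤ → sgn (a ℤ.* x) ≡ - a
sgn-sign*negative {x = -[1+ _ ]} (inj₁ refl) _ = refl
sgn-sign*negative {x = -[1+ _ ]} (inj₂ refl) _ = refl
sgn-sign*negative {x = + _}      _           (+<+ ())

u-double : ∀ n → n ≢ 0 → u (2 * n) ≡ -1ℤ
u-double zero    n≢0 = ⊥-elim (n≢0 refl)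
u-double (suc n) _   = sgn-negative (h-double-negative n)

u-double+1 : ∀ n → n ≢ 1 → u (1 + 2 * n) ≡ t n
u-double+1 zero          _   = refl
u-double+1 (suc zero)    n≢1 = ⊥-elim (n≢1 refl)
u-double+1 (suc (suc m)) _   = begin
  sgn (h (1 + 2 * (2 + m)))                     ≡⟨ cong (sgn ∘ h ∘ suc) (ℕₚ.*-suc 2 (1 + m)) ⟩
  sgn (h (3 + 2 * (1 + m)))                     ≡⟨ cong sgn (h[3+2m]≡t[3+2m]*h[2m] (1 + m)) ⟩
  sgn (t (3 + 2 * (1 + m)) ℤ.* h (2 * (1 + m))) ≡⟨ sgn-sign*negative (t-isSign (3 + 2 * (1 + m))) (h-double-negative m) ⟩
  - t (3 + 2 * (1 + m))                         ≡⟨ cong -_ (t-double+1-suc (1 + m)) ⟩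
  - - t (2 + m)                                 ≡⟨ ℤₚ.neg-involutive (t (2 + m)) ⟩
  t (2 + m)                                     ∎
  where open ≡-Reasoning

<-halve : ∀ r {q p} → r + 2 * q < 2 * p → q < p
<-halve r {q} {p} r+2q<2p = ℕₚ.*-cancelˡ-< 2 q p (ℕₚ.≤-<-trans (ℕₚ.m≤n+m (2 * q) r) r+2q<2p)

1*n+0≡n : ∀ n → 1 * n + 0 ≡ n
1*n+0≡n n = trans (ℕₚ.+-identityʳ (1 * n)) (ℕₚ.*-identityˡ n)

2^[1+i]*n+2q≡2[2^i*n+q] : ∀ i n q → 2 ^ suc i * n + 2 * q ≡ 2 * (2 ^ i * n + q)
2^[1+i]*n+2q≡2[2^i*n+q] i = identity (2 ^ i)
  where
  identity : ∀ p n q → 2 * p * n + 2 * q ≡ 2 * (p * n + q)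
  identity = ℕ-Ring.solve-∀

2^[1+i]*n+[1+2q]≡1+2[2^i*n+q] : ∀ i n q → 2 ^ suc i * n + (1 + 2 * q) ≡ 1 + 2 * (2 ^ i * n + q)
2^[1+i]*n+[1+2q]≡1+2[2^i*n+q] i = identity (2 ^ i)
  where
  identity : ∀ p n q → 2 * p * n + (1 + 2 * q) ≡ 1 + 2 * (p * n + q)
  identity = ℕ-Ring.solve-∀

t-concat : ∀ i n q → q < 2 ^ i → t (2 ^ i * n + q) ≡ t n ℤ.* t q
t-concat zero    n zero    _ = trans (cong t (1*n+0≡n n)) (sym (ℤₚ.*-identityʳ (t n)))
t-concat zero    n (suc q) (s≤s ())
t-concat (suc i) n j j<2^[1+i] with parityView j
... | even q = begin
  t (2 ^ suc i * n + 2 * q)   ≡⟨ cong t (2^[1+i]*n+2q≡2[2^i*n+q] i n q) ⟩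
  t (2 * (2 ^ i * n + q))     ≡⟨ t-double (2 ^ i * n + q) ⟩
  t (2 ^ i * n + q)           ≡⟨ t-concat i n q (<-halve 0 j<2^[1+i]) ⟩
  t n ℤ.* t q                 ≡⟨ cong (t n ℤ.*_) (sym (t-double q)) ⟩
  t n ℤ.* t (2 * q)           ∎
  where open ≡-Reasoning
... | odd q = begin
  t (2 ^ suc i * n + (1 + 2 * q)) ≡⟨ cong t (2^[1+i]*n+[1+2q]≡1+2[2^i*n+q] i n q) ⟩
  t (1 + 2 * (2 ^ i * n + q))     ≡⟨ t-double+1 (2 ^ i * n + q) ⟩
  - t (2 ^ i * n + q)             ≡⟨ cong -_ (t-concat i n q (<-halve 1 j<2^[1+i])) ⟩
  - (t n ℤ.* t q)                 ≡⟨ ℤₚ.neg-distribʳ-* (t n) (t q) ⟩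
  t n ℤ.* - t q                   ≡⟨ cong (t n ℤ.*_) (sym (t-double+1 q)) ⟩
  t n ℤ.* t (1 + 2 * q)           ∎
  where open ≡-Reasoning

zeroAtZero : (ℕ → ℤ) → ℕ → ℤ
zeroAtZero f zero    = 0ℤ
zeroAtZero f (suc n) = f (suc n)

kernelBasis : List (ℕ → ℤ)
kernelBasis = u ∷ u ∘ (λ n → 1 + 2 * n) ∷ t ∷ -_ ∘ t ∷ const -1ℤ
            ∷ zeroAtZero (const -1ℤ) ∷ zeroAtZero (-_ ∘ t) ∷ []

InKernelBasis : (ℕ → ℤ) → Set
InKernelBasis a = Any (a ≗_) kernelBasis

inKernelBasis-resp : ∀ {a b} → a ≗ b → InKernelBasis b → InKernelBasis a
inKernelBasis-resp a≗b = Any.map (λ b≗f n → trans (a≗b n) (b≗f n))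

t*sign-inKernelBasis : ∀ {c} → IsSign c → InKernelBasis (λ n → t n ℤ.* c)
t*sign-inKernelBasis (inj₁ refl) = lose (there (there (here refl))) (λ n → ℤₚ.*-identityʳ (t n))
t*sign-inKernelBasis (inj₂ refl) =
  lose (there (there (there (here refl)))) (λ n → trans (ℤₚ.*-comm (t n) -1ℤ) (ℤₚ.-1*i≡-i (t n)))

u-even-kernel : ∀ {p} q → 0 < p → InKernelBasis (λ n → u (2 * (p * n + q)))
u-even-kernel {suc p} zero    _ = lose (there (there (there (there (there (here refl)))))) u[2[pn]]
  where
  u[2[pn]] : ∀ n → u (2 * (suc p * n + 0)) ≡ zeroAtZero (const -1ℤ) n
  u[2[pn]] zero    = cong (λ m → u (2 * (m + 0))) (ℕₚ.*-zeroʳ (suc p))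
  u[2[pn]] (suc n) = u-double (suc p * suc n + 0) (λ ())
u-even-kernel {p}     (suc q) _ =
  lose (there (there (there (there (here refl))))) (λ n → u-double (p * n + suc q) (ℕₚ.m+1+n≢0 (p * n)))

2*m+q≢1 : ∀ m {q} → q ≢ 1 → 2 * m + q ≢ 1
2*m+q≢1 zero    q≢1 = q≢1
2*m+q≢1 (suc m) _   2[1+m]+q≡1 =
  ℕₚ.m+1+n≢0 m (ℕₚ.m+n≡0⇒m≡0 (m + suc (m + 0)) (ℕₚ.suc-injective 2[1+m]+q≡1))

p*[1+n]+1≢1 : ∀ {p} n → 0 < p → p * suc n + 1 ≢ 1
p*[1+n]+1≢1 {suc p} n _ p[1+n]+1≡1 = ℕₚ.m+1+n≢0 (n + p * suc n) (ℕₚ.suc-injective p[1+n]+1≡1)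

u-odd-kernel : ∀ i q → q < 2 ^ i → InKernelBasis (λ n → u (1 + 2 * (2 ^ i * n + q)))
u-odd-kernel zero    zero    _ = lose (there (here refl)) (λ n → cong (λ m → u (1 + 2 * m)) (1*n+0≡n n))
u-odd-kernel zero    (suc q) (s≤s ())
u-odd-kernel (suc i) q       q<2^[1+i] with q ≟ 1
... | yes refl = lose (there (there (there (there (there (there (here refl))))))) u[1+2[pn+1]]
  where
  p = 2 ^ suc i
  u[1+2[pn+1]] : ∀ n → u (1 + 2 * (p * n + 1)) ≡ zeroAtZero (-_ ∘ t) n
  u[1+2[pn+1]] zero    = cong (λ m → u (1 + 2 * (m + 1))) (ℕₚ.*-zeroʳ p)
  u[1+2[pn+1]] (suc n) = begin
    u (1 + 2 * (p * suc n + 1)) ≡⟨ u-double+1 (p * suc n + 1) (p*[1+n]+1≢1 n (ℕₚ.m^n>0 2 (suc i))) ⟩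
    t (p * suc n + 1)           ≡⟨ t-concat (suc i) (suc n) 1 q<2^[1+i] ⟩
    t (suc n) ℤ.* -1ℤ           ≡⟨ ℤₚ.*-comm (t (suc n)) -1ℤ ⟩
    -1ℤ ℤ.* t (suc n)           ≡⟨ ℤₚ.-1*i≡-i (t (suc n)) ⟩
    - t (suc n)                 ∎
    where open ≡-Reasoning
... | no q≢1 = inKernelBasis-resp u[1+2[pn+q]] (t*sign-inKernelBasis (t-isSign q))
  where
  u[1+2[pn+q]] : ∀ n → u (1 + 2 * (2 ^ suc i * n + q)) ≡ t n ℤ.* t q
  u[1+2[pn+q]] n = trans (u-double+1 (2 ^ suc i * n + q) pn+q≢1) (t-concat (suc i) n q q<2^[1+i])
    where
    pn+q≢1 : 2 ^ suc i * n + q ≢ 1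
    pn+q≢1 = subst (λ m → m + q ≢ 1) (sym (ℕₚ.*-assoc 2 (2 ^ i) n)) (2*m+q≢1 (2 ^ i * n) q≢1)

u-kernel : ∀ i j → j < 2 ^ i → InKernelBasis (λ n → u (2 ^ i * n + j))
u-kernel zero    zero    _ = lose (here refl) (λ n → cong u (1*n+0≡n n))
u-kernel zero    (suc j) (s≤s ())
u-kernel (suc i) j       j<2^[1+i] with parityView j
... | even q = inKernelBasis-resp (λ n → cong u (2^[1+i]*n+2q≡2[2^i*n+q] i n q))
                                  (u-even-kernel q (ℕₚ.m^n>0 2 i))
... | odd q  = inKernelBasis-resp (λ n → cong u (2^[1+i]*n+[1+2q]≡1+2[2^i*n+q] i n q))
                                  (u-odd-kernel i q (<-halve 1 j<2^[1+i]))

u-automatic : Automatic 2 u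
u-automatic = kernelBasis , u-kernel

h[2n+1]≡t[2n+1]*h[2n-2] : ∀ n → 1 ≤ n → h (2 * n + 1) ≡ t (2 * n + 1) ℤ.* h (2 * n ∸ 2)
h[2n+1]≡t[2n+1]*h[2n-2] (suc m) _ =
  subst₂ (λ i j → h i ≡ t i ℤ.* h j) (sym 2[1+m]+1≡3+2m) (sym 2[1+m]∸2≡2m) (h[3+2m]≡t[3+2m]*h[2m] m)
  where
  2[1+m]+1≡3+2m : 2 * suc m + 1 ≡ 3 + 2 * m
  2[1+m]+1≡3+2m = trans (ℕₚ.+-comm (2 * suc m) 1) (cong suc (ℕₚ.*-suc 2 m))
  2[1+m]∸2≡2m : 2 * suc m ∸ 2 ≡ 2 * m
  2[1+m]∸2≡2m = cong (_∸ 2) (ℕₚ.*-suc 2 m)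

h[4n]≡t[n]*h[4n-3] : ∀ n → 1 ≤ n → t n ≢ t (n ∸ 1) → h (4 * n) ≡ t n ℤ.* h (4 * n ∸ 3)
h[4n]≡t[n]*h[4n-3] (suc m) _ t[1+m]≢t[m] =
  subst (λ i → h i ≡ t (suc m) ℤ.* h (i ∸ 3)) (sym (4[1+m]≡4+2[2m] m)) (h[4+4m]≡t[1+m]*h[1+4m] m t[1+m]≢t[m])
  where
  4[1+m]≡4+2[2m] : ∀ m → 4 * (1 + m) ≡ 4 + 2 * (2 * m)
  4[1+m]≡4+2[2m] = ℕ-Ring.solve-∀

lemma1 : (∀ (n : ℕ) → 1 ≤ n → h (2 * n + 1) ≡ t (2 * n + 1) ℤ.* h (2 * n ∸ 2))
       × (∀ (n : ℕ) → 1 ≤ n → t n ≢ t (n ∸ 1) → h (4 * n) ≡ t n ℤ.* h (4 * n ∸ 3))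
       × (Automatic 2 u
          × u 0 ≡ + 0
          × u 3 ≡ + 0
          × (∀ (n : ℕ) → n ≢ 0 → u (2 * n) ≡ -[1+ 0 ])
          × (∀ (n : ℕ) → n ≢ 1 → u (2 * n + 1) ≡ t n))
lemma1 = h[2n+1]≡t[2n+1]*h[2n-2]
       , h[4n]≡t[n]*h[4n-3]
       , ( u-automatic
         , refl
         , refl
         , u-double
         , λ n n≢1 → trans (cong u (ℕₚ.+-comm (2 * n) 1)) (u-double+1 n n≢1))
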